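{- For any finite graph $G$ and any subgraph $H$ of $G$ that is a tree and is an isometric subgraph of $G$, we have $b(H)\le b(G)$.
   Context: $H$ is an isometric subgraph of $G$ if $d_H(u,v)=d_G(u,v)$ for all $u,v\in V(H)$. Burning process: in round 1 one node is chosen and burned; in each round $t\ge 2$, every unburned neighbour of a node burned by the end of round $t-1$ becomes burned, and one additional unburned node (if available) is chosen and burned; burned nodes stay burned. The burning number $b(\cdot)$ is the minimum number of rounds needed until all nodes are burned. -}

module Defs where

open import Level using (0ℓ)
open import Data.Nat using (ℕ; zero; suc; _+_; _<_; _≤_)
open import Data.Fin using (Fin; inject₁; fromℕ) renaming (zero to fzero; suc to fsuc)
open import Data.Maybe using (Maybe; just; nothing)
open import Data.Product using (Σ; _×_; _,_)
open import Data.Sum using (_⊎_)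
open import Data.Empty using (⊥)
open import Relation.Nullary using (¬_)
open import Relation.Binary.PropositionalEquality using (_≡_)
open import Function.Definitions using (Injective)
open import Function.Bundles using (_⇔_)

record Graph : Set₁ where
  field
    order  : ℕ
    Adj    : Fin order → Fin order → Set
    sym    : ∀ {u v} → Adj u v → Adj v u
    irrefl : ∀ {u} → ¬ Adj u u

open Graph public

Vertex : Graph → Set
Vertex G = Fin (order G)

data Walk (G : Graph) : Vertex G → Vertex G → ℕ → Set where
  here : ∀ {u} → Walk G u u 0
  step : ∀ {u w v k} → Adj G u w → Walk G w v k → Walk G u v (suc k)

-- d_G(u,v) = k : k is the minimum length of a u–v walk (undefined/∞ if none).
Dist : (G : Graph) → Vertex G → Vertex G → ℕ → Set
Dist G u v k = Walk G u v k × (∀ m → m < k → ¬ Walk G u v m)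

Connected : Graph → Set
Connected G = ∀ u v → Σ ℕ (λ k → Walk G u v k)

-- A cycle of length 3+k: distinct vertices c 0, …, c (2+k), consecutive ones
-- adjacent and the last adjacent to the first.
record Cycle (G : Graph) (k : ℕ) : Set where
  field
    c      : Fin (suc (suc (suc k))) → Vertex G
    inj    : Injective _≡_ _≡_ c
    adj    : ∀ (i : Fin (suc (suc k))) → Adj G (c (inject₁ i)) (c (fsuc i))
    close  : Adj G (c (fromℕ (suc (suc k)))) (c fzero)

Acyclic : Graph → Set
Acyclic G = ∀ k → ¬ Cycle G k

IsTree : Graph → Set
IsTree G = Connected G × Acyclic G

record Subgraph (H G : Graph) : Set where
  field
    emb     : Vertex H → Vertex G
    emb-inj : Injective _≡_ _≡_ emb
    emb-adj : ∀ {u v} → Adj H u v → Adj G (emb u) (emb v)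

-- d_H(u,v) = d_G(u,v) for all u, v ∈ V(H) (including the case both infinite).
Isometric : (H G : Graph) → Subgraph H G → Set
Isometric H G S = ∀ u v k → Dist H u v k ⇔ Dist G (Subgraph.emb S u) (Subgraph.emb S v) k

-- Burning process.  x t is the (optional) node chosen in round t+1.
-- Spread B = closed neighbourhood N[B].
Spread : (G : Graph) → (Vertex G → Set) → Vertex G → Set
Spread G B v = B v ⊎ Σ (Vertex G) (λ u → B u × Adj G u v)

Burned : (G : Graph) → (ℕ → Maybe (Vertex G)) → ℕ → Vertex G → Set
Burned G x zero    v = ⊥
Burned G x (suc t) v = Spread G (Burned G x t) v ⊎ x t ≡ just v

-- Legal choice in round t+1: the chosen node is unburned; a node may be
-- omitted only if no unburned node is available.
LegalChoice : (G : Graph) → (ℕ → Maybe (Vertex G)) → ℕ → Set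
LegalChoice G x t with x t
... | just v  = ¬ Spread G (Burned G x t) v
... | nothing = ∀ v → Spread G (Burned G x t) v

BurnsIn : Graph → ℕ → Set
BurnsIn G k = Σ (ℕ → Maybe (Vertex G)) λ x →
  (∀ t → t < k → LegalChoice G x t) × (∀ v → Burned G x k v)

IsBurningNumber : Graph → ℕ → Set
IsBurningNumber G b = BurnsIn G b × (∀ k → k < b → ¬ BurnsIn G k)

module Submission where

-- Let G burn in k rounds, the source of round t + 1 being c_t.  Every
-- vertex of G lies within r_t = k − (t + 1) of some c_t.  Pull back the ball
-- B_G(c_t, r_t) to H: by isometry its vertices are pairwise within 2 r_t in H,
-- and in a tree such a set lies in a ball B_H(y_t, r_t) (a Helly-type
-- property, proved via a diametral pair and the midpoint of a geodesic
-- between them).  The balls B_H(y_t, r_t) cover H, so burning y_t in round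
-- t + 1 — or any unburned vertex when y_t is already burned — is a legal
-- burning of H in k rounds; hence b(H) ≤ b(G).
--
-- Decidability of adjacency, needed for the constructions, is
-- available under double negation, which suffices since ≤ is decidable.

open import Defs hiding (sym)
open import Data.Nat using (ℕ; zero; suc; _+_; _∸_; _≤_; _<_; z≤n; s≤s; _≤?_; _<?_; _≟_)
open import Data.Nat.Properties
open import Data.Fin using (Fin; toℕ) renaming (zero to fzero; suc to fsuc)
open import Data.Fin.Properties using (any?; toℕ-injective; toℕ-inject₁; toℕ-fromℕ; toℕ<n) renaming (_≟_ to _≟F_)
open import Data.Maybe using (Maybe; just; nothing)
open import Data.Maybe.Properties using (≡-dec)
open import Data.Product using (Σ; _×_; _,_; proj₁; proj₂; ∃)
open import Data.Sum using (_⊎_; inj₁; inj₂; reduce)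
open import Data.Empty using (⊥; ⊥-elim)
open import Relation.Nullary using (¬_; Dec; yes; no)
open import Relation.Nullary.Decidable using (_×-dec_; _⊎-dec_; ¬?; decidable-stable; ¬¬-excluded-middle)
open import Relation.Binary.Definitions using (tri<; tri≈; tri>)
open import Relation.Binary.PropositionalEquality using (_≡_; refl; sym; trans; cong; subst; subst₂)
open import Function.Bundles using (Equivalence)

least : (P : ℕ → Set) → (∀ n → Dec (P n)) → ∀ n →
        (∀ j → j < n → ¬ P j) ⊎ Σ ℕ (λ m → m < n × P m × (∀ j → j < m → ¬ P j))
least P P? zero = inj₁ (λ j ())
least P P? (suc n) with least P P? n
... | inj₂ (m , m<n , Pm , below) = inj₂ (m , m≤n⇒m≤1+n m<n , Pm , below)
... | inj₁ none with P? n
...   | yes Pn = inj₂ (n , ≤-refl , Pn , none)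
...   | no ¬Pn = inj₁ none′
  where
  none′ : ∀ j → j < suc n → ¬ P j
  none′ j j<1+n with m<1+n⇒m<n∨m≡n j<1+n
  ... | inj₁ j<n  = none j j<n
  ... | inj₂ refl = ¬Pn

argmax : ∀ {n} (P : Fin n → Set) → (∀ i → Dec (P i)) → (f : Fin n → ℕ) → Σ (Fin n) P →
         Σ (Fin n) λ i → P i × (∀ j → P j → f j ≤ f i)
argmax {suc n} P P? f (i₀ , Pi₀) with any? (λ j → P? (fsuc j))
... | no none = fzero , subst P (only-zero Pi₀) Pi₀ , λ j Pj → ≤-reflexive (cong f (only-zero Pj))
  where
  only-zero : ∀ {j} → P j → j ≡ fzero
  only-zero {fzero}  _  = refl
  only-zero {fsuc j} Pj = ⊥-elim (none (j , Pj))
... | yes witness with argmax (λ j → P (fsuc j)) (λ j → P? (fsuc j)) (λ j → f (fsuc j)) witness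
...   | i , Pi , best with P? fzero
...     | no ¬P0 = fsuc i , Pi , λ { fzero P0 → ⊥-elim (¬P0 P0) ; (fsuc j) Pj → best j Pj }
...     | yes P0 with f fzero ≤? f (fsuc i)
...       | yes le = fsuc i , Pi , λ { fzero _ → le ; (fsuc j) Pj → best j Pj }
...       | no gt = fzero , P0 , λ { fzero _ → ≤-refl
                                  ; (fsuc j) Pj → ≤-trans (best j Pj) (<⇒≤ (≰⇒> gt)) }

diametral-pair : ∀ {n} (P : Fin n → Set) → (∀ i → Dec (P i)) → (d : Fin n → Fin n → ℕ) →
                 Σ (Fin n) P → Σ (Fin n) λ u → Σ (Fin n) λ v →
                 P u × P v × (∀ s s′ → P s → P s′ → d s s′ ≤ d u v)
diametral-pair {n} P P? d nonempty =
  from-eccentric (argmax P P? (λ s → d s (proj₁ (farthest s))) nonempty)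
  where
  farthest : ∀ s → Σ (Fin n) λ v → P v × (∀ s′ → P s′ → d s s′ ≤ d s v)
  farthest s = argmax P P? (d s) nonempty

  -- u maximises the distance to its farthest point; u and that point form the pair.
  from-eccentric : Σ (Fin n) (λ u → P u × (∀ s → P s → d s (proj₁ (farthest s)) ≤ d u (proj₁ (farthest u)))) →
                   Σ (Fin n) λ u → Σ (Fin n) λ v → P u × P v × (∀ s s′ → P s → P s′ → d s s′ ≤ d u v)
  from-eccentric (u , Pu , u-best) =
    u , proj₁ (farthest u) , Pu , proj₁ (proj₂ (farthest u)) ,
    λ s s′ Ps Ps′ → ≤-trans (proj₂ (proj₂ (farthest s)) s′ Ps′) (u-best s Ps)

overflow-split : ∀ {r D} → r < D → D ≤ r + r →
                 Σ ℕ λ a → Σ ℕ λ b → suc a ≡ r × suc b ≤ r × suc a + suc b ≡ D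
overflow-split {zero} 0<D D≤0 = ⊥-elim (<⇒≱ 0<D D≤0)
overflow-split {suc a} {D} r<D D≤2r
  with D ∸ suc a | m+[n∸m]≡n (<⇒≤ r<D) | m<n⇒0<n∸m r<D | m≤n+o⇒m∸n≤o D (suc a) D≤2r
... | suc b | D≡ | _ | b<r = a , b , refl , b<r , D≡   -- D − r = 0 is ruled out by 0 < D − r

Within : (G : Graph) → Vertex G → Vertex G → ℕ → Set
Within G u v r = Σ ℕ λ m → m ≤ r × Walk G u v m

walk-length-0 : ∀ {G u v} → Walk G u v 0 → u ≡ v
walk-length-0 here = refl

module Walks (G : Graph) where
  V : Set
  V = Vertex G

  _++_ : ∀ {u w v j k} → Walk G u w j → Walk G w v k → Walk G u v (j + k)
  here     ++ w′ = w′
  step a w ++ w′ = step a (w ++ w′)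

  snoc : ∀ {u w v k} → Walk G u w k → Adj G w v → Walk G u v (suc k)
  snoc here       a = step a here
  snoc (step b w) a = step b (snoc w a)

  reverse : ∀ {u v k} → Walk G u v k → Walk G v u k
  reverse here       = here
  reverse (step a w) = snoc (reverse w) (Graph.sym G a)

  split : ∀ {u v} i j → Walk G u v (i + j) → Σ V λ y → Walk G u y i × Walk G y v j
  split zero    j w = _ , here , w
  split (suc i) j (step a w) with split i j w
  ... | y , w₁ , w₂ = y , step a w₁ , w₂

  -- The vertex reached after i steps (the last one if i exceeds the length).
  at : ∀ {u v k} → Walk G u v k → ℕ → V
  at {u} w          zero    = u
  at {u} here       (suc i) = u
  at     (step a w) (suc i) = at w i

  at-end : ∀ {u v k} (w : Walk G u v k) → at w k ≡ v
  at-end here       = refl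
  at-end (step a w) = at-end w

  at-adj : ∀ {u v k} (w : Walk G u v k) i → i < k → Adj G (at w i) (at w (suc i))
  at-adj (step a w) zero    _       = a
  at-adj (step a w) (suc i) (s≤s i<k) = at-adj w i i<k

  at-split : ∀ {u v k} (w : Walk G u v k) i → i ≤ k →
             Walk G u (at w i) i × Walk G (at w i) v (k ∸ i)
  at-split w          zero    _         = here , w
  at-split (step a w) (suc i) (s≤s i≤k) with at-split w i i≤k
  ... | w₁ , w₂ = step a w₁ , w₂

  second : ∀ {u v k} → Walk G u v (suc k) → V
  second (step {w = p} a w) = p

  at-1 : ∀ {u v k} (w : Walk G u v (suc k)) → at w 1 ≡ second w
  at-1 (step a here)       = refl
  at-1 (step a (step b w)) = refl

  shortcut : ∀ {y u v a b} (w₁ : Walk G y u (suc a)) (w₂ : Walk G y v (suc b)) →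
             second w₁ ≡ second w₂ → Walk G u v (a + b)
  shortcut (step _ w₁) (step _ w₂) refl = reverse w₁ ++ w₂

  Dist-≤ : ∀ {u v d m} → Dist G u v d → Walk G u v m → d ≤ m
  Dist-≤ {d = d} {m} (_ , shortest) w with m <? d
  ... | yes m<d = ⊥-elim (shortest m m<d w)
  ... | no  m≮d = ≮⇒≥ m≮d

  Dist-unique : ∀ {u v d e} → Dist G u v d → Dist G u v e → d ≡ e
  Dist-unique Dd De = ≤-antisym (Dist-≤ Dd (proj₁ De)) (Dist-≤ De (proj₁ Dd))

  Dist-split : ∀ {u v} i j → Dist G u v (i + j) →
               Σ V λ y → Dist G y u i × Dist G y v j
  Dist-split i j (w , shortest) with split i j w
  ... | y , w₁ , w₂ =
    y , (reverse w₁ , λ m m<i w′ → shortest (m + j) (+-monoˡ-< j m<i) (reverse w′ ++ w₂))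
      , (w₂ , λ m m<j w′ → shortest (i + m) (+-monoʳ-< i m<j) (w₁ ++ w′))

  Dist-split-branches : ∀ {u v y a b} → Dist G u v (suc a + suc b) →
                        (Du : Dist G y u (suc a)) (Dv : Dist G y v (suc b)) →
                        ¬ second (proj₁ Du) ≡ second (proj₁ Dv)
  Dist-split-branches {a = a} {b} D Du Dv same =
    <⇒≱ a+b<D (Dist-≤ D (shortcut (proj₁ Du) (proj₁ Dv) same))
    where
    a+b<D : a + b < suc a + suc b
    a+b<D = s≤s (≤-trans (n≤1+n (a + b)) (≤-reflexive (sym (+-suc a b))))

  Dist-prefix : ∀ {u v k} (D : Dist G u v k) i → i ≤ k → Dist G u (at (proj₁ D) i) i
  Dist-prefix {k = k} (w , shortest) i i≤k with at-split w i i≤k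
  ... | w₁ , w₂ = w₁ , λ j j<i w′ → shortest (j + (k ∸ i)) (shorter j<i) (w′ ++ w₂)
    where
    shorter : ∀ {j} → j < i → j + (k ∸ i) < k
    shorter {j} j<i = begin-strict
      j + (k ∸ i) <⟨ +-monoˡ-< (k ∸ i) j<i ⟩
      i + (k ∸ i) ≡⟨ m+[n∸m]≡n i≤k ⟩
      k           ∎
      where open ≤-Reasoning

  -- On geodesics leaving the same vertex, the i-th vertex is at distance i,
  -- so a common vertex occurs at the same position on both.
  Dist-positions : ∀ {y a b A B} (Da : Dist G y a A) (Db : Dist G y b B) i j → i ≤ A → j ≤ B →
                   at (proj₁ Da) i ≡ at (proj₁ Db) j → i ≡ j
  Dist-positions {y} Da Db i j i≤A j≤B eq =
    Dist-unique (Dist-prefix Da i i≤A) (subst (λ z → Dist G y z j) (sym eq) (Dist-prefix Db j j≤B))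

module DecidableWalks (G : Graph) (adj? : ∀ u v → Dec (Adj G u v)) where
  open Walks G

  walk? : ∀ u v k → Dec (Walk G u v k)
  walk? u v zero with u ≟F v
  ... | yes refl = yes here
  ... | no  u≢v  = no λ { here → u≢v refl }
  walk? u v (suc k) with any? (λ w → adj? u w ×-dec walk? w v k)
  ... | yes (w , a , rest) = yes (step a rest)
  ... | no  none           = no λ { (step {w = w} a rest) → none (w , a , rest) }

  geodesic : ∀ {u v k} → Walk G u v k → Σ ℕ λ d → d ≤ k × Dist G u v d
  geodesic {u} {v} {k} w with least (Walk G u v) (walk? u v) (suc k)
  ... | inj₁ none = ⊥-elim (none k ≤-refl w)
  ... | inj₂ (d , d<1+k , wd , shortest) = d , ≤-pred d<1+k , wd , shortest

  within? : ∀ u v r → Dec (Within G u v r)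
  within? u v r with least (Walk G u v) (walk? u v) (suc r)
  ... | inj₁ none = no λ { (m , m≤r , w) → none m (s≤s m≤r) w }
  ... | inj₂ (m , m<1+r , w , _) = yes (m , ≤-pred m<1+r , w)

module Cycles (G : Graph) where
  closed-path-cycle : ∀ k (h : ℕ → Vertex G) →
    (∀ i → i < suc (suc k) → Adj G (h i) (h (suc i))) → Adj G (h (suc (suc k))) (h 0) →
    (∀ i j → i < suc (suc (suc k)) → j < suc (suc (suc k)) → h i ≡ h j → i ≡ j) → Cycle G k
  closed-path-cycle k h adj close inj = record
    { c     = λ i → h (toℕ i)
    ; inj   = λ {i} {j} eq → toℕ-injective (inj _ _ (toℕ<n i) (toℕ<n j) eq)
    ; adj   = λ i → subst (λ n → Adj G (h n) (h (suc (toℕ i)))) (sym (toℕ-inject₁ i))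
                          (adj (toℕ i) (toℕ<n i))
    ; close = subst (λ n → Adj G (h n) (h 0)) (sym (toℕ-fromℕ (suc (suc k)))) close
    }

  -- Two paths f 0 … f A and g 0 … g B (A, B ≥ 1) leaving the common vertex
  -- f 0 = g 0, meeting nowhere else and with adjacent endpoints f A, g B,
  -- close up to the cycle f 0 … f A g B … g 1.
  module TwoPaths (f g : ℕ → Vertex G) (A′ B′ : ℕ)
    (start : f 0 ≡ g 0)
    (f-adj : ∀ i → i < suc A′ → Adj G (f i) (f (suc i)))
    (g-adj : ∀ j → j < suc B′ → Adj G (g j) (g (suc j)))
    (link  : Adj G (f (suc A′)) (g (suc B′)))
    (f-inj : ∀ i j → i ≤ suc A′ → j ≤ suc A′ → f i ≡ f j → i ≡ j)
    (g-inj : ∀ i j → i ≤ suc B′ → j ≤ suc B′ → g i ≡ g j → i ≡ j)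
    (meet  : ∀ i j → i ≤ suc A′ → j ≤ suc B′ → f i ≡ g j → j ≡ 0) where

    A B N : ℕ
    A = suc A′
    B = suc B′
    N = suc (suc (suc (A′ + B′)))   -- = A + B + 1, the length of the cycle

    h : ℕ → Vertex G
    h n with n ≤? A
    ... | yes _ = f n
    ... | no  _ = g (N ∸ n)

    h-f : ∀ {n} → n ≤ A → h n ≡ f n
    h-f {n} n≤A with n ≤? A
    ... | yes _   = refl
    ... | no  n≰A = ⊥-elim (n≰A n≤A)

    h-g : ∀ {n} → A < n → h n ≡ g (N ∸ n)
    h-g {n} A<n with n ≤? A
    ... | yes n≤A = ⊥-elim (<⇒≱ A<n n≤A)
    ... | no  _   = refl

    N∸A≡B : N ∸ suc A ≡ B
    N∸A≡B = trans (cong (_∸ A′) (sym (+-suc A′ B′))) (m+n∸m≡n A′ B)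

    g-index : ∀ {n} → A < n → N ∸ n ≤ B
    g-index A<n = ≤-trans (∸-monoʳ-≤ N A<n) (≤-reflexive N∸A≡B)

    g-step : ∀ {n} → A < n → n < suc (suc (A′ + B′)) →
             N ∸ n ≡ suc (N ∸ suc n) × N ∸ suc n < B
    g-step {n} A<n n<N =
      +-∸-assoc 1 (m≤n⇒m≤1+n n<N) ,
      s≤s (≤-trans (∸-monoʳ-≤ N (s≤s A<n)) (≤-reflexive (m+n∸m≡n A′ B′)))

    h-adj : ∀ n → n < suc (suc (A′ + B′)) → Adj G (h n) (h (suc n))
    h-adj n n<N with <-cmp n A
    ... | tri< n<A _ _ rewrite h-f (<⇒≤ n<A) | h-f n<A = f-adj n n<A
    ... | tri≈ _ refl _ rewrite h-f (≤-refl {A}) | h-g (≤-refl {suc A}) | N∸A≡B = link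
    ... | tri> _ _ A<n with g-step A<n n<N
    ...   | eq , j<B rewrite h-g A<n | h-g (m≤n⇒m≤1+n A<n) | eq =
            Graph.sym G (g-adj (N ∸ suc n) j<B)

    h-close : Adj G (h (suc (suc (A′ + B′)))) (h 0)
    h-close rewrite h-g (s≤s (s≤s (m≤m+n A′ B′))) | m+n∸n≡m 1 (suc (suc (A′ + B′)))
                  | h-f (z≤n {A}) | start = Graph.sym G (g-adj 0 (s≤s z≤n))

    h-inj : ∀ i j → i < N → j < N → h i ≡ h j → i ≡ j
    h-inj i j i<N j<N eq = by-cases (i ≤? A) (j ≤? A)
      where
      by-cases : Dec (i ≤ A) → Dec (j ≤ A) → i ≡ j
      by-cases (yes i≤A) (yes j≤A) = f-inj i j i≤A j≤A (trans (sym (h-f i≤A)) (trans eq (h-f j≤A)))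
      by-cases (no  i≰A) (no  j≰A) = ∸-cancelˡ-≡ (<⇒≤ i<N) (<⇒≤ j<N)
        (g-inj _ _ (g-index (≰⇒> i≰A)) (g-index (≰⇒> j≰A))
          (trans (sym (h-g (≰⇒> i≰A))) (trans eq (h-g (≰⇒> j≰A)))))
      by-cases (yes i≤A) (no  j≰A) = ⊥-elim (<⇒≢ (m<n⇒0<n∸m j<N)
        (sym (meet i _ i≤A (g-index (≰⇒> j≰A)) (trans (sym (h-f i≤A)) (trans eq (h-g (≰⇒> j≰A)))))))
      by-cases (no  i≰A) (yes j≤A) = ⊥-elim (<⇒≢ (m<n⇒0<n∸m i<N)
        (sym (meet j _ j≤A (g-index (≰⇒> i≰A)) (trans (sym (h-f j≤A)) (trans (sym eq) (h-g (≰⇒> i≰A)))))))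

    cycle : Cycle G (A′ + B′)
    cycle = closed-path-cycle (A′ + B′) h h-adj h-close h-inj

module Tree (T : Graph) (adj? : ∀ u v → Dec (Adj T u v))
            (acyclic : Acyclic T) (connected : Connected T) where
  open Walks T
  open DecidableWalks T adj?
  open Cycles T

  -- Two geodesics from y whose endpoints are equal or adjacent take the same
  -- first step: otherwise they would close up a cycle.
  module FirstSteps {y a b A′ B′} (Da : Dist T y a (suc A′)) (Db : Dist T y b (suc B′)) where
    f g : ℕ → V
    f = at (proj₁ Da)
    g = at (proj₁ Db)

    -- The geodesics meet again at position 1 + i.
    MeetAt : ℕ → Set
    MeetAt i = suc i ≤ suc A′ × suc i ≤ suc B′ × f (suc i) ≡ g (suc i)

    meet? : ∀ i → Dec (MeetAt i)
    meet? i = (suc i ≤? suc A′) ×-dec ((suc i ≤? suc B′) ×-dec (f (suc i) ≟F g (suc i)))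

    -- A common vertex sits at the same position on both geodesics, so if they
    -- do not meet at positions 1 … n, then below n they share only y.
    apart : ∀ n → (∀ j → j < n → ¬ MeetAt j) →
            ∀ i j → i ≤ suc A′ → j ≤ suc B′ → (i ≤ n ⊎ j ≤ n) → f i ≡ g j → j ≡ 0
    apart n none i j i≤A j≤B bound eq with Dist-positions Da Db i j i≤A j≤B eq
    apart n none i zero i≤A j≤B bound eq | refl = refl
    apart n none (suc j) (suc j) i≤A j≤B bound eq | refl = ⊥-elim (none j (reduce bound) (i≤A , j≤B , eq))

    never-meet : (∀ j → j < suc A′ → ¬ MeetAt j) → a ≡ b ⊎ Adj T a b → ⊥
    never-meet none (inj₁ refl) with Dist-unique Da Db
    ... | refl = none A′ ≤-refl (≤-refl , ≤-refl , trans (at-end (proj₁ Da)) (sym (at-end (proj₁ Db))))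
    never-meet none (inj₂ a~b) = acyclic _ (TwoPaths.cycle f g A′ B′ refl
      (at-adj (proj₁ Da)) (at-adj (proj₁ Db))
      (subst₂ (Adj T) (sym (at-end (proj₁ Da))) (sym (at-end (proj₁ Db))) a~b)
      (Dist-positions Da Da) (Dist-positions Db Db)
      (λ i j i≤A j≤B → apart (suc A′) none i j i≤A j≤B (inj₁ i≤A)))

    -- Meeting first at a position 2 + m closes the cycle y … f (2+m) = g (2+m), g (1+m) … .
    late-meet : ∀ m → MeetAt (suc m) → (∀ j → j < suc m → ¬ MeetAt j) → ⊥
    late-meet m (A-bound , B-bound , eq) earlier = acyclic _ (TwoPaths.cycle f g (suc m) m refl
      (λ i i<m → at-adj (proj₁ Da) i (≤-trans i<m A-bound))
      (λ j j<m → at-adj (proj₁ Db) j (≤-trans j<m B-bound′))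
      (subst (λ z → Adj T z (g (suc m))) (sym eq) (Graph.sym T (at-adj (proj₁ Db) (suc m) B-bound)))
      (λ i j i≤ j≤ → Dist-positions Da Da i j (≤-trans i≤ A-bound) (≤-trans j≤ A-bound))
      (λ i j i≤ j≤ → Dist-positions Db Db i j (≤-trans i≤ B-bound′) (≤-trans j≤ B-bound′))
      (λ i j i≤ j≤ → apart (suc m) earlier i j (≤-trans i≤ A-bound) (≤-trans j≤ B-bound′) (inj₂ j≤)))
      where
      B-bound′ : suc m ≤ suc B′
      B-bound′ = ≤-trans (n≤1+n (suc m)) B-bound

    same-first-step : a ≡ b ⊎ Adj T a b → second (proj₁ Da) ≡ second (proj₁ Db)
    same-first-step ends with least MeetAt meet? (suc A′)
    ... | inj₁ none = ⊥-elim (never-meet none ends)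
    ... | inj₂ (zero , _ , (_ , _ , eq) , _) = trans (sym (at-1 (proj₁ Da))) (trans eq (at-1 (proj₁ Db)))
    ... | inj₂ (suc m , _ , meet , earlier) = ⊥-elim (late-meet m meet earlier)

  open FirstSteps using (same-first-step)

  dist : V → V → ℕ
  dist u v = proj₁ (geodesic (proj₂ (connected u v)))

  dist-spec : ∀ u v → Dist T u v (dist u v)
  dist-spec u v = proj₂ (proj₂ (geodesic (proj₂ (connected u v))))

  geodesic-from : ∀ y z → ¬ z ≡ y → Σ ℕ λ a → Dist T y z (suc a)
  geodesic-from y z z≢y with dist y z | dist-spec y z
  ... | zero  | D = ⊥-elim (z≢y (sym (walk-length-0 (proj₁ D))))
  ... | suc a | D = a , D

  separated : ∀ {y z t a b} (Dz : Dist T y z (suc a)) (Dt : Dist T y t (suc b)) →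
              ¬ second (proj₁ Dz) ≡ second (proj₁ Dt) → ∀ {n} → Walk T z t n → suc a + suc b ≤ n
  separated Dz Dt branches here = ⊥-elim (branches (same-first-step Dz Dt (inj₁ refl)))
  separated {y} Dz Dt branches (step {w = z′} z~z′ w) with z′ ≟F y
  -- If the walk first steps to y, then d(y,z) = 1 and the rest is a walk from y to t.
  ... | yes refl with Dist-≤ Dz (step (Graph.sym T z~z′) here)
  ...   | s≤s z≤n = s≤s (Dist-≤ Dt w)
  separated {y} {b = b} Dz Dt branches (step {w = z′} z~z′ w) | no z′≢y
    -- Otherwise z′ lies in the branch of z, and d(y,z) ≤ d(y,z′) + 1.
    with geodesic-from y z′ z′≢y
  ... | a′ , Dz′ = ≤-trans (+-monoˡ-≤ (suc b) (Dist-≤ Dz (snoc (proj₁ Dz′) (Graph.sym T z~z′))))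
                           (s≤s (separated Dz′ Dt branches′ w))
    where
    branches′ : ¬ second (proj₁ Dz′) ≡ second (proj₁ Dt)
    branches′ same = branches (trans (same-first-step Dz Dz′ (inj₂ z~z′)) same)

  midpoint-radius : ∀ {u v y a b r s k} → Dist T u v (suc a + suc b) →
    (Du : Dist T y u (suc a)) (Dv : Dist T y v (suc b)) → suc a ≤ r → suc b ≤ r →
    Within T s u (suc a + suc b) → Within T s v (suc a + suc b) → Dist T y s k → k ≤ r
  midpoint-radius {k = zero} _ _ _ _ _ _ _ _ = z≤n
  midpoint-radius {a = a} {b} {k = suc k} D Du Dv a<r b<r (_ , su≤ , su) (_ , sv≤ , sv) Ds
    with second (proj₁ Ds) ≟F second (proj₁ Dv)
  ... | no other-branch =    -- then d(s,v) = d(s,y) + (1 + b), so 1 + k ≤ 1 + a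
    ≤-trans (+-cancelʳ-≤ (suc b) (suc k) (suc a) (≤-trans (separated Ds Dv other-branch sv) sv≤)) a<r
  ... | yes same-branch =    -- then d(s,u) = d(s,y) + (1 + a), so 1 + k ≤ 1 + b
    ≤-trans (+-cancelʳ-≤ (suc a) (suc k) (suc b)
              (≤-trans (separated Ds Du branch-u su) (≤-trans su≤ (≤-reflexive (+-comm (suc a) (suc b)))))) b<r
    where
    branch-u : ¬ second (proj₁ Ds) ≡ second (proj₁ Du)
    branch-u same = Dist-split-branches D Du Dv (trans (sym same) same-branch)

  within-dist : ∀ {x s n} → dist x s ≤ n → Within T x s n
  within-dist {x} {s} d≤n = dist x s , d≤n , proj₁ (dist-spec x s)

  -- For a diametral pair u, v the
  -- centre is u if d(u,v) ≤ r, and otherwise the vertex at distance r from u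
  -- on a u–v geodesic.
  module Centre (S : V → Set) (r : ℕ) (close : ∀ s s′ → S s → S s′ → Within T s s′ (r + r))
                (u v : V) (Su : S u) (Sv : S v)
                (diametral : ∀ s s′ → S s → S s′ → dist s s′ ≤ dist u v) where
    D≤2r : dist u v ≤ r + r
    D≤2r with close u v Su Sv
    ... | m , m≤2r , w = ≤-trans (Dist-≤ (dist-spec u v) w) m≤2r

    near : ∀ {n} → dist u v ≤ n → ∀ x s → S x → S s → Within T x s n
    near D≤n x s Sx Ss = within-dist (≤-trans (diametral x s Sx Ss) D≤n)

    centre : Dec (dist u v ≤ r) → Σ V λ y → ∀ s → S s → Within T y s r
    centre (yes D≤r) = u , λ s Ss → near D≤r u s Su Ss
    centre (no D≰r) with overflow-split (≰⇒> D≰r) D≤2r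
    ... | a , b , refl , b<r , D≡ with subst (Dist T u v) (sym D≡) (dist-spec u v)
    ...   | geod with Dist-split (suc a) (suc b) geod
    ...     | y , Du , Dv = y , λ s Ss → within-dist
              (midpoint-radius geod Du Dv ≤-refl b<r (near D≤D′ s u Ss Su) (near D≤D′ s v Ss Sv) (dist-spec y s))
      where
      D≤D′ : dist u v ≤ suc a + suc b
      D≤D′ = ≤-reflexive (sym D≡)

  centre : (S : V → Set) → (∀ v → Dec (S v)) → ∀ r → (∀ s s′ → S s → S s′ → Within T s s′ (r + r)) →
           Σ V S → Σ V λ y → ∀ s → S s → Within T y s r
  centre S S? r close nonempty with diametral-pair S S? dist nonempty
  ... | u , v , Su , Sv , diametral = Centre.centre S r close u v Su Sv diametral (dist u v ≤? r)

burned-source : ∀ {G} (x : ℕ → Maybe (Vertex G)) k v → Burned G x k v →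
  Σ ℕ λ t → t < k × Σ (Vertex G) λ c → x t ≡ just c × Within G c v (k ∸ suc t)
burned-source x (suc k) v (inj₂ chosen) = k , ≤-refl , v , chosen , 0 , z≤n , here
burned-source x (suc k) v (inj₁ (inj₁ burned)) with burned-source x k v burned
... | t , t<k , c , chosen , m , m≤ , w =
  t , m≤n⇒m≤1+n t<k , c , chosen , m , ≤-trans m≤ (∸-monoʳ-≤ k (n≤1+n t)) , w
burned-source {G} x (suc k) v (inj₁ (inj₂ (u , burned , u~v))) with burned-source x k u burned
... | t , t<k , c , chosen , m , m≤ , w =
  t , m≤n⇒m≤1+n t<k , c , chosen , suc m ,
  ≤-trans (s≤s m≤) (≤-reflexive (sym (+-∸-assoc 1 t<k))) , Walks.snoc G w u~v

module Burning (G : Graph) (x : ℕ → Maybe (Vertex G)) where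

  burned-mono : ∀ {s s′ v} → s ≤ s′ → Burned G x s v → Burned G x s′ v
  burned-mono {s} {s′} s≤s′ b with m≤n⇒m<n∨m≡n s≤s′
  ... | inj₂ refl = b
  burned-mono {s} {suc s′} _ b | inj₁ s<s′ = inj₁ (inj₁ (burned-mono (≤-pred s<s′) b))

  burned-along : ∀ {s z v m} → Burned G x s z → Walk G z v m → Burned G x (s + m) v
  burned-along {s} {z} b here = subst (λ q → Burned G x q z) (sym (+-identityʳ s)) b
  burned-along {s} {v = v} {suc m} b (step {w = z′} a w) =
    subst (λ q → Burned G x q v) (sym (+-suc s m)) (burned-along (inj₁ (inj₂ (_ , b , a))) w)

burned-ext : ∀ {G} (x y : ℕ → Maybe (Vertex G)) t → (∀ i → i < t → x i ≡ y i) →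
             ∀ v → Burned G x t v → Burned G y t v
spread-ext : ∀ {G} (x y : ℕ → Maybe (Vertex G)) t → (∀ i → i < t → x i ≡ y i) →
             ∀ v → Spread G (Burned G x t) v → Spread G (Burned G y t) v
burned-ext x y (suc t) agree v (inj₁ spread) = inj₁ (spread-ext x y t (λ i i<t → agree i (m≤n⇒m≤1+n i<t)) v spread)
burned-ext x y (suc t) agree v (inj₂ chosen) = inj₂ (trans (sym (agree t ≤-refl)) chosen)
spread-ext x y t agree v (inj₁ b) = inj₁ (burned-ext x y t agree v b)
spread-ext x y t agree v (inj₂ (u , b , a)) = inj₂ (u , burned-ext x y t agree u b , a)

module DecidableBurning (G : Graph) (adj? : ∀ u v → Dec (Adj G u v)) where
  burned? : (x : ℕ → Maybe (Vertex G)) → ∀ t v → Dec (Burned G x t v)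
  spread? : (x : ℕ → Maybe (Vertex G)) → ∀ t v → Dec (Spread G (Burned G x t) v)
  burned? x zero    v = no λ ()
  burned? x (suc t) v = spread? x t v ⊎-dec ≡-dec _≟F_ (x t) (just v)
  spread? x t v = burned? x t v ⊎-dec any? (λ u → burned? x t u ×-dec adj? u v)

Legal : (G : Graph) → (ℕ → Maybe (Vertex G)) → ℕ → Maybe (Vertex G) → Set
Legal G x n (just v) = ¬ Spread G (Burned G x n) v
Legal G x n nothing  = ∀ v → Spread G (Burned G x n) v

legal-choice : ∀ G x t → Legal G x t (x t) → LegalChoice G x t
legal-choice G x t legal with x t
... | just v  = legal
... | nothing = legal

legal-ext : ∀ {G} (x y : ℕ → Maybe (Vertex G)) t → (∀ i → i < t → x i ≡ y i) →
            ∀ m → Legal G x t m → Legal G y t m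
legal-ext x y t agree (just v) legal spread = legal (spread-ext y x t (λ i i<t → sym (agree i i<t)) v spread)
legal-ext x y t agree nothing  legal v      = spread-ext x y t agree v (legal v)

-- A plan assigning to round t + 1 (t < k) a node whose ball of radius
-- k − (t + 1) is part of a cover of H yields a legal burning in k rounds:
-- follow the plan while its node is unburned, otherwise burn any unburned node.
module Greedy (H : Graph) (adj? : ∀ u v → Dec (Adj H u v)) (k : ℕ) (plan : ℕ → Maybe (Vertex H))
  (cover : ∀ v → Σ ℕ λ t → t < k × Σ (Vertex H) λ y → plan t ≡ just y × Within H y v (k ∸ suc t)) where
  open DecidableBurning H adj?

  V : Set
  V = Vertex H

  module Round (x : ℕ → Maybe V) (n : ℕ) where
    Reached : V → Set
    Reached = Spread H (Burned H x n)

    any-unreached : Dec (∃ λ v → ¬ Reached v) → Maybe V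
    any-unreached (yes (v , _)) = just v
    any-unreached (no _)        = nothing

    any-unreached-legal : (d : Dec (∃ λ v → ¬ Reached v)) → Legal H x n (any-unreached d)
    any-unreached-legal (yes (v , unreached)) = unreached
    any-unreached-legal (no none) v with spread? x n v
    ... | yes reached  = reached
    ... | no unreached = ⊥-elim (none (v , unreached))

    fallback : Maybe V
    fallback = any-unreached (any? (λ v → ¬? (spread? x n v)))

    fallback-legal : Legal H x n fallback
    fallback-legal = any-unreached-legal (any? (λ v → ¬? (spread? x n v)))

    prefer : (y : V) → Dec (Reached y) → Maybe V
    prefer y (yes _) = fallback
    prefer y (no _)  = just y

    choose : Maybe V → Maybe V
    choose (just y) = prefer y (spread? x n y)
    choose nothing  = fallback

    choose-legal : ∀ m → Legal H x n (choose m)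
    choose-legal (just y) with spread? x n y
    ... | yes _        = fallback-legal
    ... | no unreached = unreached
    choose-legal nothing = fallback-legal

    choose-planned : ∀ y → Reached y ⊎ choose (just y) ≡ just y
    choose-planned y with spread? x n y
    ... | yes reached = inj₁ reached
    ... | no _        = inj₂ refl

  history : ℕ → ℕ → Maybe V
  history zero    _ = nothing
  history (suc n) i with i ≟ n
  ... | yes _ = Round.choose (history n) n (plan n)
  ... | no  _ = history n i

  x : ℕ → Maybe V
  x t = Round.choose (history t) t (plan t)

  history-agrees : ∀ t i → i < t → history t i ≡ x i
  history-agrees (suc t) i i<1+t with i ≟ t
  ... | yes refl = refl
  ... | no  i≢t  = history-agrees t i (≤∧≢⇒< (≤-pred i<1+t) i≢t)

  legal : ∀ t → LegalChoice H x t
  legal t = legal-choice H x t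
    (legal-ext (history t) x t (history-agrees t) (x t) (Round.choose-legal (history t) t (plan t)))

  planned-burned : ∀ t y → plan t ≡ just y → Burned H x (suc t) y
  planned-burned t y planned rewrite planned with Round.choose-planned (history t) t y
  ... | inj₁ reached = inj₁ (spread-ext (history t) x t (history-agrees t) y reached)
  ... | inj₂ chosen  = inj₂ chosen

  all-burned : ∀ v → Burned H x k v
  all-burned v with cover v
  ... | t , t<k , y , planned , m , m≤ , w =
    burned-mono (≤-trans (+-monoʳ-≤ (suc t) m≤) (≤-reflexive (m+[n∸m]≡n t<k)))
      (burned-along (planned-burned t y planned) w)
    where open Burning H x

  burns : BurnsIn H k
  burns = x , (λ t _ → legal t) , all-burned

module Transfer (G H : Graph) (S : Subgraph H G) (tree : IsTree H) (iso : Isometric H G S)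
                (adjG? : ∀ u v → Dec (Adj G u v)) (adjH? : ∀ u v → Dec (Adj H u v)) where
  open Subgraph S using (emb)
  open Tree H adjH? (proj₂ tree) (proj₁ tree) using (centre)
  open Walks G using (reverse; _++_)
  open DecidableWalks G adjG? using (geodesic; within?)

  InBall : Vertex G → ℕ → Vertex H → Set
  InBall c r h = Within G c (emb h) r

  ball-diameter : ∀ c r s s′ → InBall c r s → InBall c r s′ → Within H s s′ (r + r)
  ball-diameter c r s s′ (m , m≤r , w) (m′ , m′≤r , w′) with geodesic (reverse w ++ w′)
  ... | d , d≤ , D = d , ≤-trans d≤ (+-mono-≤ m≤r m′≤r) , proj₁ (Equivalence.from (iso s s′ d) D)

  ball-centre : ∀ c r → Σ (Maybe (Vertex H)) λ m →
                ∀ h → InBall c r h → Σ (Vertex H) λ y → m ≡ just y × Within H y h r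
  ball-centre c r with any? (λ h → within? c (emb h) r)
  ... | no empty = nothing , λ h inside → ⊥-elim (empty (h , inside))
  ... | yes nonempty with centre (InBall c r) (λ h → within? c (emb h) r) r (ball-diameter c r) nonempty
  ...   | y , near = just y , λ h inside → y , refl , near h inside

  source-centre : ℕ → Maybe (Vertex G) → Maybe (Vertex H)
  source-centre r (just c) = proj₁ (ball-centre c r)
  source-centre r nothing  = nothing

  source-centre-near : ∀ r m c → m ≡ just c → ∀ h → InBall c r h →
                       Σ (Vertex H) λ y → source-centre r m ≡ just y × Within H y h r
  source-centre-near r .(just c) c refl = proj₂ (ball-centre c r)

  burns-transfer : ∀ k → BurnsIn G k → BurnsIn H k
  burns-transfer k (xG , _ , all-burned) = Greedy.burns H adjH? k plan cover
    where
    plan : ℕ → Maybe (Vertex H)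
    plan t = source-centre (k ∸ suc t) (xG t)

    cover : ∀ h → Σ ℕ λ t → t < k × Σ (Vertex H) λ y → plan t ≡ just y × Within H y h (k ∸ suc t)
    cover h with burned-source xG k (emb h) (all-burned (emb h))
    ... | t , t<k , c , chosen , inside with source-centre-near (k ∸ suc t) (xG t) c chosen h inside
    ...   | y , planned , near = t , t<k , y , planned , near

¬¬-finite-∀ : ∀ n (P : Fin n → Set) → (∀ i → ¬ ¬ P i) → ¬ ¬ (∀ i → P i)
¬¬-finite-∀ zero    P _  no-all = no-all (λ ())
¬¬-finite-∀ (suc n) P nn no-all = nn fzero λ P0 → ¬¬-finite-∀ n (λ i → P (fsuc i)) (λ i → nn (fsuc i))
  λ rest → no-all λ { fzero → P0 ; (fsuc i) → rest i }

¬¬-decidable-adjacency : (G : Graph) → ¬ ¬ (∀ u v → Dec (Adj G u v))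
¬¬-decidable-adjacency G =
  ¬¬-finite-∀ _ _ λ u → ¬¬-finite-∀ _ _ λ v → ¬¬-excluded-middle

theorem8 : (G H : Graph) (S : Subgraph H G) → IsTree H → Isometric H G S →
           (bG bH : ℕ) → IsBurningNumber G bG → IsBurningNumber H bH → bH ≤ bG
theorem8 G H S tree iso bG bH (G-burns , _) (_ , H-minimal) =
  decidable-stable (bH ≤? bG) λ bH≰bG →
    ¬¬-decidable-adjacency G λ adjG? → ¬¬-decidable-adjacency H λ adjH? →
      H-minimal bG (≰⇒> bH≰bG) (Transfer.burns-transfer G H S tree iso adjG? adjH? bG G-burns)
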